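{- Let $n_1\ge n_2\ge\cdots\ge n_k\ge 0$ with $k\ge1$. Then there is a binary tree $t$ with $\mathcal{L}(t)=[n_1,n_2,\dots,n_k]$ such that the decreasing polynomial $(B^{n_1}B)\circ(B^{n_2}B)\circ\cdots\circ(B^{n_k}B)$ is $\beta\eta$-equivalent to the $\lambda$-term corresponding to $t$.
   Context: $B=\lambda f.\lambda g.\lambda x.\, f\,(g\,x)$; $B$-terms are combinatory terms built from $B$ by application, identified with their $\lambda$-terms; $e_1\circ e_2$ denotes $B\,e_1\,e_2$; $B^0B=B$, $B^{n+1}B=B\,(B^nB)$. Binary trees are built from a leaf $\star$ and the binary node $\langle t_1,t_2\rangle$. The $\lambda$-term corresponding to a binary tree $t$ with $m$ leaves is $\lambda x_1.\cdots\lambda x_m.\,M$, where $M$ is obtained from $t$ by reading $\langle t_1,t_2\rangle$ as application $t_1\,t_2$ and labelling the leaves by $x_1,\dots,x_m$ from left to right. For an integer $i$ define lists of integers $\mathcal{L}_i(\star)=[\,]$ and $\mathcal{L}_i(\langle t_1,t_2\rangle)=\mathcal{L}_{i+|t_1|}(t_2)\mathbin{+\!\!+}\mathcal{L}_i(t_1)\mathbin{+\!\!+}[i]$, where $\mathbin{+\!\!+}$ is list concatenation and $|t_1|$ is the number of leaves of $t_1$. $\mathcal{L}(t)$ is the list obtained from $\mathcal{L}_{ -1}(t)$ by removing all trailing entries $-1$ (equivalently, keeping its non-negative entries). -}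

module Defs where

open import Data.Nat using (ℕ; zero; suc; _+_; _≥_; _<?_)
open import Data.Integer using (ℤ; +_; -[1+_]; _≟_) renaming (_+_ to _+ℤ_)
open import Data.List using (List; []; _∷_; _++_; reverse; dropWhile)
open import Relation.Nullary using (¬_)
open import Relation.Nullary.Decidable using (¬?)
open import Relation.Binary.Construct.Closure.Equivalence using (EqClosure)

data Tree : Set where
  ⋆   : Tree
  ⟨_,_⟩ : Tree → Tree → Tree

∣_∣ : Tree → ℕ
∣ ⋆ ∣ = 1
∣ ⟨ t₁ , t₂ ⟩ ∣ = ∣ t₁ ∣ + ∣ t₂ ∣

𝓛[_] : ℤ → Tree → List ℤ
𝓛[ i ] ⋆ = []
𝓛[ i ] ⟨ t₁ , t₂ ⟩ = 𝓛[ i +ℤ + ∣ t₁ ∣ ] t₂ ++ 𝓛[ i ] t₁ ++ (i ∷ [])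

𝓛 : Tree → List ℤ
𝓛 t = reverse (dropWhile (λ z → z ≟ -[1+ 0 ]) (reverse (𝓛[ -[1+ 0 ] ] t)))

data Term : Set where
  var : ℕ → Term
  app : Term → Term → Term
  lam : Term → Term

shift : ℕ → Term → Term
shift c (var x) with x <? c
... | Relation.Nullary.yes _ = var x
... | Relation.Nullary.no _  = var (suc x)
shift c (app M N) = app (shift c M) (shift c N)
shift c (lam M) = lam (shift (suc c) M)

-- substitution M[j := N] with removal of the binder j
-- (variables > j are decremented); N lives in the outer context.
subst : ℕ → Term → Term → Term
subst j N (var x) with Data.Nat.compare x j
... | Data.Nat.less _ _    = var x
... | Data.Nat.equal _     = N
... | Data.Nat.greater _ k = var (j + k)
subst j N (app M₁ M₂) = app (subst j N M₁) (subst j N M₂)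
subst j N (lam M) = lam (subst (suc j) (shift 0 N) M)

data _⟶_ : Term → Term → Set where
  β     : ∀ {M N} → app (lam M) N ⟶ subst 0 N M
  η     : ∀ {M} → lam (app (shift 0 M) (var 0)) ⟶ M
  appˡ  : ∀ {M M' N} → M ⟶ M' → app M N ⟶ app M' N
  appʳ  : ∀ {M N N'} → N ⟶ N' → app M N ⟶ app M N'
  lamξ  : ∀ {M M'} → M ⟶ M' → lam M ⟶ lam M'

_≃βη_ : Term → Term → Set
_≃βη_ = EqClosure _⟶_

B : Term
B = lam (lam (lam (app (var 2) (app (var 1) (var 0)))))

B^_B : ℕ → Term
B^ zero B = B
B^ suc n B = app B (B^ n B)

_∘B_ : Term → Term → Term
e₁ ∘B e₂ = app (app B e₁) e₂

-- decreasing polynomial (B^{n₁}B) ∘ (B^{n₂}B) ∘ ⋯ ∘ (B^{n_k}B),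
-- nested to the right; first argument is n₁, the list is [n₂,…,n_k]
poly : ℕ → List ℕ → Term
poly n [] = B^ n B
poly n (m ∷ ms) = (B^ n B) ∘B poly m ms

-- body; r = number of leaves to the right of the current subtree,
-- so the j-th leaf (1-based, left to right) is x_j = var (m - j)
body : ℕ → Tree → Term
body r ⋆ = var r
body r ⟨ t₁ , t₂ ⟩ = app (body (r + ∣ t₂ ∣) t₁) (body r t₂)

lams : ℕ → Term → Term
lams zero M = M
lams (suc m) M = lam (lams m M)

⟦_⟧ : Tree → Term
⟦ t ⟧ = lams ∣ t ∣ (body 0 t)

-- Say that P realises a tree t if P applied to |t| or more arguments is
-- βη-equal to the body of t over the first |t| of them.  Since
-- B^n B f a₁ ⋯ aₙ a b ≃ f a₁ ⋯ aₙ (a b), precomposing with B^n B contracts two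
-- consecutive arguments, so B^n B ∘ P realises t with ⟨⋆,⋆⟩ grafted onto its
-- leaf with n+1 leaves to the left; extra arguments, i.e. padding t on the
-- left by ⟨_,⋆⟩, supply that leaf if t is too small.  When the leaf is
-- reached descending left only past leaf siblings, the graft prepends n to 𝓛.
-- The exponents decrease, and grafting at position n+1 keeps every position
-- above n suitable, so such a leaf is always available.
module Submission where

open import Data.Bool using (true; false)
open import Data.Integer as ℤ using (ℤ; +_; -[1+_])
import Data.Integer.Properties as ℤₚ
open import Data.List using (List; []; _∷_; _++_; _∷ʳ_; reverse; dropWhile; map)
open import Data.List.Properties using (reverse-++; unfold-reverse)
open import Data.List.Relation.Unary.Linked using (Linked; _∷_)
open import Data.Nat
open import Data.Nat.Properties
open import Data.Nat.Tactic.RingSolver using (solve-∀)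
open import Data.Product using (∃; ∃₂; _×_; _,_)
open import Data.Sum using (inj₁; inj₂)
open import Function using (_∘_)
open import Relation.Binary.Construct.Closure.Equivalence using (gmap; return; setoid)
open import Relation.Binary.Construct.Closure.ReflexiveTransitive using (ε)
open import Relation.Binary.PropositionalEquality as ≡
  using (_≡_; _≢_; refl; sym; trans; cong; cong₂; module ≡-Reasoning)
import Relation.Binary.Reasoning.Setoid as SetoidReasoning
open import Relation.Binary.Definitions using (tri<; tri≈; tri>)
open import Relation.Nullary using (¬_; yes; no; does; contradiction)
open import Relation.Unary using (Pred; Decidable)

open import Defs

shift-var-< : ∀ {c x} → x < c → shift c (var x) ≡ var x
shift-var-< {c} {x} x<c with x <? c
... | yes _   = refl
... | no x≮c = contradiction x<c x≮c

shift-var-≥ : ∀ {c x} → c ≤ x → shift c (var x) ≡ var (suc x)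
shift-var-≥ {c} {x} c≤x with x <? c
... | yes x<c = contradiction c≤x (<⇒≱ x<c)
... | no _    = refl

subst-var-< : ∀ {j N x} → x < j → subst j N (var x) ≡ var x
subst-var-< {j} {N} {x} x<j with compare x j
... | less _ _    = refl
... | equal _     = contradiction x<j (<-irrefl refl)
... | greater _ k = contradiction x<j (<-asym (s≤s (m≤m+n j k)))

subst-var-> : ∀ {j N x} → j ≤ x → subst j N (var (suc x)) ≡ var x
subst-var-> {j} {N} {x} j≤x with compare (suc x) j
... | less _ k    = contradiction j≤x (<⇒≱ (s≤s (≤-trans (n≤1+n x) (m≤m+n (suc x) k))))
... | equal _     = contradiction j≤x (<⇒≱ ≤-refl)
... | greater _ _ = refl

subst-shift : ∀ j N M → subst j N (shift j M) ≡ M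
subst-shift j N (var x) with <-≤-connex x j
... | inj₁ x<j rewrite shift-var-< x<j = subst-var-< x<j
... | inj₂ j≤x rewrite shift-var-≥ j≤x = subst-var-> j≤x
subst-shift j N (app M₁ M₂) = cong₂ app (subst-shift j N M₁) (subst-shift j N M₂)
subst-shift j N (lam M)     = cong lam (subst-shift (suc j) (shift 0 N) M)

shift-shift : ∀ {c d} M → c ≤ d → shift (suc d) (shift c M) ≡ shift c (shift d M)
shift-shift {c} {d} (var x) c≤d with <-≤-connex x c | <-≤-connex x d
... | inj₁ x<c | _
  rewrite shift-var-< (<-≤-trans x<c c≤d) | shift-var-< x<c
        | shift-var-< (m<n⇒m<1+n (<-≤-trans x<c c≤d)) = refl
... | inj₂ c≤x | inj₁ x<d
  rewrite shift-var-< x<d | shift-var-≥ c≤x | shift-var-< (s≤s x<d) = refl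
... | inj₂ c≤x | inj₂ d≤x
  rewrite shift-var-≥ d≤x | shift-var-≥ c≤x | shift-var-≥ (s≤s d≤x) | shift-var-≥ (m≤n⇒m≤1+n c≤x) = refl
shift-shift (app M N) c≤d = cong₂ app (shift-shift M c≤d) (shift-shift N c≤d)
shift-shift (lam M)   c≤d = cong lam (shift-shift M (s≤s c≤d))

shift-B^B : ∀ c n → shift c (B^ n B) ≡ B^ n B
shift-B^B c zero    = refl
shift-B^B c (suc n) = cong (app B) (shift-B^B c n)

shift-poly : ∀ c n ms → shift c (poly n ms) ≡ poly n ms
shift-poly c n []       = shift-B^B c n
shift-poly c n (m ∷ ms) = cong₂ (λ X P → app (app B X) P) (shift-B^B c n) (shift-poly c m ms)

module ≃-Reasoning = SetoidReasoning (setoid _⟶_)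

app-congˡ : ∀ {M M′ N} → M ≃βη M′ → app M N ≃βη app M′ N
app-congˡ {N = N} = gmap (λ M → app M N) appˡ

lam-cong : ∀ {M M′} → M ≃βη M′ → lam M ≃βη lam M′
lam-cong = gmap lam lamξ

lams-cong : ∀ m {M M′} → M ≃βη M′ → lams m M ≃βη lams m M′
lams-cong zero    M≃M′ = M≃M′
lams-cong (suc m) M≃M′ = lam-cong (lams-cong m M≃M′)

B-β : ∀ f g x → app (app (app B f) g) x ≃βη app f (app g x)
B-β f g x = begin
  app (app (app B f) g) x
    ≈⟨ return (appˡ (appˡ β)) ⟩
  app (app (lam (lam (app (shift 0 (shift 0 f)) (app (var 1) (var 0))))) g) x
    ≈⟨ return (appˡ β) ⟩
  app (lam (app (subst 1 (shift 0 g) (shift 0 (shift 0 f))) (app (shift 0 g) (var 0)))) x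
    ≈⟨ return β ⟩
  app (subst 0 x (subst 1 (shift 0 g) (shift 0 (shift 0 f)))) (app (subst 0 x (shift 0 g)) x)
    ≡⟨ cong₂ (λ f′ g′ → app f′ (app g′ x)) f-eq (subst-shift 0 x g) ⟩
  app f (app g x) ∎
  where
  open ≃-Reasoning
  f-eq : subst 0 x (subst 1 (shift 0 g) (shift 0 (shift 0 f))) ≡ f
  f-eq = trans (cong (subst 0 x ∘ subst 1 (shift 0 g)) (sym (shift-shift f z≤n)))
           (trans (cong (subst 0 x) (subst-shift 1 (shift 0 g) (shift 0 f))) (subst-shift 0 x f))

-- Spines of arguments and their contraction

-- apps M f K = M (f (K ∸ 1)) ⋯ (f 1) (f 0): arguments are numbered from the last.
apps : Term → (ℕ → Term) → ℕ → Term
apps M f zero    = M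
apps M f (suc K) = app (apps M (f ∘ suc) K) (f 0)

apps-suc : ∀ M f K → apps M f (suc K) ≡ apps (app M (f K)) f K
apps-suc M f zero    = refl
apps-suc M f (suc K) = cong (λ N → app N (f 0)) (apps-suc M (f ∘ suc) K)

apps-cong : ∀ {M f g} K → (∀ {j} → j < K → f j ≡ g j) → apps M f K ≡ apps M g K
apps-cong zero    f≡g = refl
apps-cong (suc K) f≡g = cong₂ app (apps-cong K (f≡g ∘ s≤s)) (f≡g z<s)

apps-congˡ : ∀ {M M′} f K → M ≃βη M′ → apps M f K ≃βη apps M′ f K
apps-congˡ f zero    M≃M′ = M≃M′
apps-congˡ f (suc K) M≃M′ = app-congˡ (apps-congˡ (f ∘ suc) K M≃M′)

shift-apps : ∀ c M f K → shift c (apps M f K) ≡ apps (shift c M) (shift c ∘ f) K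
shift-apps c M f zero    = refl
shift-apps c M f (suc K) = cong (λ N → app N (shift c (f 0))) (shift-apps c M (f ∘ suc) K)

lams-suc : ∀ m M → lams (suc m) M ≡ lams m (lam M)
lams-suc zero    M = refl
lams-suc (suc m) M = cong lam (lams-suc m M)

lams-apps-η : ∀ P → shift 0 P ≡ P → ∀ m → lams m (apps P var m) ≃βη P
lams-apps-η P P-closed zero    = ε
lams-apps-η P P-closed (suc m) = begin
  lams (suc m) (apps P var (suc m))                        ≡⟨ lams-suc m _ ⟩
  lams m (lam (app (apps P (var ∘ suc) m) (var 0)))        ≡⟨ cong (λ N → lams m (lam (app N (var 0)))) shifted ⟨
  lams m (lam (app (shift 0 (apps P var m)) (var 0)))      ≈⟨ lams-cong m (return η) ⟩
  lams m (apps P var m)                                    ≈⟨ lams-apps-η P P-closed m ⟩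
  P                                                        ∎
  where
  open ≃-Reasoning
  shifted : shift 0 (apps P var m) ≡ apps P (var ∘ suc) m
  shifted = trans (shift-apps 0 P var m)
                  (trans (cong (λ N → apps N (shift 0 ∘ var) m) P-closed) (apps-cong m (λ _ → shift-var-≥ z≤n)))

contract : ℕ → (ℕ → Term) → ℕ → Term
contract q g j with <-cmp j q
... | tri< _ _ _ = g j
... | tri≈ _ _ _ = app (g (suc q)) (g q)
... | tri> _ _ _ = g (suc j)

contract-< : ∀ {q g j} → j < q → contract q g j ≡ g j
contract-< {q} {g} {j} j<q with <-cmp j q
... | tri< _ _ _   = refl
... | tri≈ j≮q _ _ = contradiction j<q j≮q
... | tri> j≮q _ _ = contradiction j<q j≮q

contract-≡ : ∀ {q g} → contract q g q ≡ app (g (suc q)) (g q)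
contract-≡ {q} with <-cmp q q
... | tri< _ q≢q _ = contradiction refl q≢q
... | tri≈ _ _ _   = refl
... | tri> _ q≢q _ = contradiction refl q≢q

contract-> : ∀ {q g j} → q < j → contract q g j ≡ g (suc j)
contract-> {q} {g} {j} q<j with <-cmp j q
... | tri< _ _ j≯q = contradiction q<j j≯q
... | tri≈ _ _ j≯q = contradiction q<j j≯q
... | tri> _ _ _   = refl

apps-contract-last : ∀ f g q n →
  apps (app f (g (2 + (n + q)))) (contract q g) (1 + (n + q)) ≡ apps f (contract q g) (2 + (n + q))
apps-contract-last f g q n = trans
  (cong (λ x → apps (app f x) (contract q g) (1 + (n + q))) (sym (contract-> (s≤s (m≤n+m q n)))))
  (sym (apps-suc f (contract q g) (1 + (n + q))))

B^nB-contract : ∀ n q f g → apps (app (B^ n B) f) g (2 + (n + q)) ≃βη apps f (contract q g) (1 + (n + q))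
B^nB-contract zero q f g = begin
  apps (app B f) g (2 + q)                             ≡⟨ trans (apps-suc _ g (1 + q)) (apps-suc _ g q) ⟩
  apps (app (app (app B f) (g (1 + q))) (g q)) g q     ≈⟨ apps-congˡ g q (B-β f (g (1 + q)) (g q)) ⟩
  apps (app f (app (g (1 + q)) (g q))) g q             ≡⟨ apps-cong q (sym ∘ contract-<) ⟩
  apps (app f (app (g (1 + q)) (g q))) (contract q g) q ≡⟨ cong (λ x → apps (app f x) (contract q g) q) (contract-≡ {q} {g}) ⟨
  apps (app f (contract q g q)) (contract q g) q       ≡⟨ apps-suc f (contract q g) q ⟨
  apps f (contract q g) (1 + q)                        ∎
  where open ≃-Reasoning
B^nB-contract (suc n) q f g = begin
  apps (app (B^ suc n B) f) g (3 + K)                        ≡⟨ apps-suc _ g (2 + K) ⟩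
  apps (app (app (app B (B^ n B)) f) (g (2 + K))) g (2 + K)  ≈⟨ apps-congˡ g (2 + K) (B-β (B^ n B) f (g (2 + K))) ⟩
  apps (app (B^ n B) (app f (g (2 + K)))) g (2 + K)          ≈⟨ B^nB-contract n q (app f (g (2 + K))) g ⟩
  apps (app f (g (2 + K))) (contract q g) (1 + K)            ≡⟨ apps-contract-last f g q n ⟩
  apps f (contract q g) (2 + K)                              ∎
  where
  open ≃-Reasoning
  K = n + q

-- Trees, grafting and realisation

bodyWith : ℕ → Tree → (ℕ → Term) → Term
bodyWith r ⋆             g = g r
bodyWith r ⟨ t₁ , t₂ ⟩ g = app (bodyWith (r + ∣ t₂ ∣) t₁ g) (bodyWith r t₂ g)

body≡bodyWith-var : ∀ r t → body r t ≡ bodyWith r t var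
body≡bodyWith-var r ⋆             = refl
body≡bodyWith-var r ⟨ t₁ , t₂ ⟩ = cong₂ app (body≡bodyWith-var (r + ∣ t₂ ∣) t₁) (body≡bodyWith-var r t₂)

bodyWith-cong : ∀ {r g h} t → (∀ {j} → r ≤ j → g j ≡ h j) → bodyWith r t g ≡ bodyWith r t h
bodyWith-cong {r} ⋆             g≡h = g≡h ≤-refl
bodyWith-cong {r} ⟨ t₁ , t₂ ⟩ g≡h =
  cong₂ app (bodyWith-cong t₁ (g≡h ∘ ≤-trans (m≤m+n r _))) (bodyWith-cong t₂ g≡h)

bodyWith-suc : ∀ r t g → bodyWith (suc r) t g ≡ bodyWith r t (g ∘ suc)
bodyWith-suc r ⋆             g = refl
bodyWith-suc r ⟨ t₁ , t₂ ⟩ g = cong₂ app (bodyWith-suc (r + ∣ t₂ ∣) t₁ g) (bodyWith-suc r t₂ g)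

Realises : Term → Tree → Set
Realises P t = ∀ g d → apps P g (d + ∣ t ∣) ≃βη apps (bodyWith d t g) g d

pad : Tree → ℕ → Tree
pad t zero    = t
pad t (suc D) = ⟨ pad t D , ⋆ ⟩

∣pad∣ : ∀ t D → ∣ pad t D ∣ ≡ D + ∣ t ∣
∣pad∣ t zero    = refl
∣pad∣ t (suc D) = trans (+-comm ∣ pad t D ∣ 1) (cong suc (∣pad∣ t D))

apps-bodyWith-pad : ∀ t D d g → apps (bodyWith d (pad t D) g) g d ≡ apps (bodyWith (d + D) t g) g (d + D)
apps-bodyWith-pad t zero    d g = cong (λ j → apps (bodyWith j t g) g j) (sym (+-identityʳ d))
apps-bodyWith-pad t (suc D) d g = begin
  apps (app (bodyWith (d + 1) (pad t D) g) (g d)) g d ≡⟨ cong (λ j → apps (app (bodyWith j (pad t D) g) (g d)) g d) (+-comm d 1) ⟩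
  apps (app (bodyWith (suc d) (pad t D) g) (g d)) g d ≡⟨ apps-suc _ g d ⟨
  apps (bodyWith (suc d) (pad t D) g) g (suc d)       ≡⟨ apps-bodyWith-pad t D (suc d) g ⟩
  apps (bodyWith (suc d + D) t g) g (suc d + D)       ≡⟨ cong (λ j → apps (bodyWith j t g) g j) (+-suc d D) ⟨
  apps (bodyWith (d + suc D) t g) g (d + suc D)       ∎
  where open ≡-Reasoning

-- A leaf of t with k leaves to its left and p to its right, reached from the
-- root by descending to the left only past leaf siblings; grafting ⟨⋆,⋆⟩
-- there prepends an entry to 𝓛 (see 𝓛ᵢ-graft).
data Graftable : ℕ → ℕ → Tree → Set where
  here  : Graftable 0 0 ⋆
  left  : ∀ {k p t} → Graftable k p t → Graftable k (suc p) ⟨ t , ⋆ ⟩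
  right : ∀ {k p t₁ t₂} → Graftable k p t₂ → Graftable (∣ t₁ ∣ + k) p ⟨ t₁ , t₂ ⟩

graft : ∀ {k p t} → Graftable k p t → Tree
graft here                 = ⟨ ⋆ , ⋆ ⟩
graft (left e)             = ⟨ graft e , ⋆ ⟩
graft (right {t₁ = t₁} e) = ⟨ t₁ , graft e ⟩

∣graft∣ : ∀ {k p t} (e : Graftable k p t) → ∣ graft e ∣ ≡ suc ∣ t ∣
∣graft∣ here                 = refl
∣graft∣ (left e)             = cong (_+ 1) (∣graft∣ e)
∣graft∣ (right {t₁ = t₁} e) = trans (cong (_+_ ∣ t₁ ∣) (∣graft∣ e)) (+-suc ∣ t₁ ∣ _)

graftable-size : ∀ {k p t} → Graftable k p t → suc (k + p) ≡ ∣ t ∣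
graftable-size here                         = refl
graftable-size (left {k} {p} e)             =
  trans (cong suc (+-suc k p)) (trans (+-comm 1 (suc (k + p))) (cong (_+ 1) (graftable-size e)))
graftable-size (right {k} {p} {t₁} e) =
  trans (cong suc (+-assoc ∣ t₁ ∣ k p)) (trans (sym (+-suc ∣ t₁ ∣ (k + p))) (cong (_+_ ∣ t₁ ∣) (graftable-size e)))

graftable-left< : ∀ {k p t} → Graftable k p t → k < ∣ t ∣
graftable-left< {k} {p} e = ≡.subst (k <_) (graftable-size e) (s≤s (m≤m+n k p))

graftable-right< : ∀ {k p t} → Graftable k p t → p < ∣ t ∣
graftable-right< {k} {p} e = ≡.subst (p <_) (graftable-size e) (s≤s (m≤n+m p k))

bodyWith-graft : ∀ {k p t} (e : Graftable k p t) r g → bodyWith r (graft e) g ≡ bodyWith r t (contract (r + p) g)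
bodyWith-graft here r g = begin
  app (g (r + 1)) (g r) ≡⟨ cong (λ j → app (g j) (g r)) (+-comm r 1) ⟩
  app (g (suc r)) (g r) ≡⟨ contract-≡ {r} {g} ⟨
  contract r g r        ≡⟨ cong (λ q → contract q g r) (+-identityʳ r) ⟨
  contract (r + 0) g r  ∎
  where open ≡-Reasoning
bodyWith-graft (left {p = p} {t} e) r g = cong₂ app
  (trans (bodyWith-graft e (r + 1) g) (cong (λ q → bodyWith (r + 1) t (contract q g)) (+-assoc r 1 p)))
  (sym (contract-< (m<m+n r z<s)))
bodyWith-graft (right {p = p} {t₁} {t₂} e) r g = cong₂ app left-part (bodyWith-graft e r g)
  where
  left-part : bodyWith (r + ∣ graft e ∣) t₁ g ≡ bodyWith (r + ∣ t₂ ∣) t₁ (contract (r + p) g)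
  left-part = begin
    bodyWith (r + ∣ graft e ∣) t₁ g         ≡⟨ cong (λ j → bodyWith (r + j) t₁ g) (∣graft∣ e) ⟩
    bodyWith (r + suc ∣ t₂ ∣) t₁ g          ≡⟨ cong (λ j → bodyWith j t₁ g) (+-suc r ∣ t₂ ∣) ⟩
    bodyWith (suc (r + ∣ t₂ ∣)) t₁ g        ≡⟨ bodyWith-suc (r + ∣ t₂ ∣) t₁ g ⟩
    bodyWith (r + ∣ t₂ ∣) t₁ (g ∘ suc)
      ≡⟨ bodyWith-cong t₁ (contract-> ∘ <-≤-trans (+-monoʳ-< r (graftable-right< e))) ⟨
    bodyWith (r + ∣ t₂ ∣) t₁ (contract (r + p) g) ∎
    where open ≡-Reasoning

apps-bodyWith-graft : ∀ {k p t D} (e : Graftable k p (pad t D)) d g →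
  let c = contract (d + p) g in apps (bodyWith d (graft e) g) g d ≡ apps (bodyWith (d + D) t c) c (d + D)
apps-bodyWith-graft {p = p} {t} {D} e d g = begin
  apps (bodyWith d (graft e) g) g d       ≡⟨ cong (λ x → apps x g d) (bodyWith-graft e d g) ⟩
  apps (bodyWith d (pad t D) c) g d       ≡⟨ apps-cong d (sym ∘ contract-< ∘ λ j<d → <-≤-trans j<d (m≤m+n d p)) ⟩
  apps (bodyWith d (pad t D) c) c d       ≡⟨ apps-bodyWith-pad t D d c ⟩
  apps (bodyWith (d + D) t c) c (d + D)   ∎
  where
  open ≡-Reasoning
  c = contract (d + p) g

graft-arity : ∀ {n p t} (e : Graftable (suc n) p t) d → d + ∣ graft e ∣ ≡ 3 + (n + (d + p))
graft-arity {n} {p} e d =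
  trans (cong (_+_ d) (trans (∣graft∣ e) (cong suc (sym (graftable-size e))))) (arith d n p)
  where
  arith : ∀ d n p → d + suc (suc (suc (n + p))) ≡ suc (suc (suc (n + (d + p))))
  arith = solve-∀

pad-graftable-arity : ∀ {n p t D} (e : Graftable (suc n) p (pad t D)) d → (d + D) + ∣ t ∣ ≡ 2 + (n + (d + p))
pad-graftable-arity {n} {p} {t} {D} e d =
  trans (+-assoc d D ∣ t ∣) (trans (cong (_+_ d) (sym (trans (graftable-size e) (∣pad∣ t D)))) (arith d n p))
  where
  arith : ∀ d n p → d + suc (suc (n + p)) ≡ suc (suc (n + (d + p)))
  arith = solve-∀

B^nB-realises : ∀ {n p D} (e : Graftable (suc n) p (pad ⋆ D)) → Realises (B^ n B) (graft e)
B^nB-realises {n} {p} {D} e g d = begin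
  apps (B^ n B) g (d + ∣ graft e ∣)          ≡⟨ cong (apps _ g) (graft-arity e d) ⟩
  apps (B^ n B) g (3 + K)                    ≡⟨ apps-suc _ g (2 + K) ⟩
  apps (app (B^ n B) (g (2 + K))) g (2 + K)  ≈⟨ B^nB-contract n q (g (2 + K)) g ⟩
  apps (g (2 + K)) c (1 + K)                 ≡⟨ cong (λ x → apps x c (1 + K)) (contract-> (s≤s (m≤n+m q n))) ⟨
  apps (c (1 + K)) c (1 + K)                 ≡⟨ cong (λ j → apps (c j) c j) d+D≡1+K ⟨
  apps (bodyWith (d + D) ⋆ c) c (d + D)      ≡⟨ apps-bodyWith-graft e d g ⟨
  apps (bodyWith d (graft e) g) g d          ∎
  where
  open ≃-Reasoning
  q = d + p
  K = n + q
  c = contract q g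
  d+D≡1+K : d + D ≡ 1 + K
  d+D≡1+K = suc-injective (trans (+-comm 1 (d + D)) (pad-graftable-arity e d))

∘B-realises : ∀ {P t n p D} → Realises P t → (e : Graftable (suc n) p (pad t D)) → Realises (B^ n B ∘B P) (graft e)
∘B-realises {P} {t} {n} {p} {D} P⊨t e g d = begin
  apps (B^ n B ∘B P) g (d + ∣ graft e ∣)           ≡⟨ cong (apps _ g) (graft-arity e d) ⟩
  apps (B^ n B ∘B P) g (3 + K)                     ≡⟨ apps-suc _ g (2 + K) ⟩
  apps (app (B^ n B ∘B P) (g (2 + K))) g (2 + K)   ≈⟨ apps-congˡ g (2 + K) (B-β (B^ n B) P (g (2 + K))) ⟩
  apps (app (B^ n B) (app P (g (2 + K)))) g (2 + K) ≈⟨ B^nB-contract n q (app P (g (2 + K))) g ⟩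
  apps (app P (g (2 + K))) c (1 + K)               ≡⟨ apps-contract-last P g q n ⟩
  apps P c (2 + K)                                 ≡⟨ cong (apps P c) (pad-graftable-arity e d) ⟨
  apps P c ((d + D) + ∣ t ∣)                       ≈⟨ P⊨t c (d + D) ⟩
  apps (bodyWith (d + D) t c) c (d + D)            ≡⟨ apps-bodyWith-graft e d g ⟨
  apps (bodyWith d (graft e) g) g d                ∎
  where
  open ≃-Reasoning
  q = d + p
  K = n + q
  c = contract q g

-- The list 𝓛 under padding and grafting

dropWhile-∷ʳ : ∀ {a p} {A : Set a} {P : Pred A p} (P? : Decidable P) xs {x} →
               ¬ P x → dropWhile P? (xs ∷ʳ x) ≡ dropWhile P? xs ∷ʳ x
dropWhile-∷ʳ P? [] {x} ¬Px with P? x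
... | yes Px = contradiction Px ¬Px
... | no _   = refl
dropWhile-∷ʳ P? (y ∷ ys) ¬Px with does (P? y)
... | true  = dropWhile-∷ʳ P? ys ¬Px
... | false = refl

dropTrailing : List ℤ → List ℤ
dropTrailing xs = reverse (dropWhile (λ z → z ℤ.≟ -[1+ 0 ]) (reverse xs))

dropTrailing-∷ : ∀ {x} xs → x ≢ -[1+ 0 ] → dropTrailing (x ∷ xs) ≡ x ∷ dropTrailing xs
dropTrailing-∷ {x} xs x≢-1 = begin
  reverse (dropWhile _ (reverse (x ∷ xs)))    ≡⟨ cong (reverse ∘ dropWhile _) (unfold-reverse x xs) ⟩
  reverse (dropWhile _ (reverse xs ∷ʳ x))     ≡⟨ cong reverse (dropWhile-∷ʳ _ (reverse xs) x≢-1) ⟩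
  reverse (dropWhile _ (reverse xs) ∷ʳ x)     ≡⟨ reverse-++ (dropWhile _ (reverse xs)) (x ∷ []) ⟩
  x ∷ dropTrailing xs                         ∎
  where open ≡-Reasoning

dropTrailing-∷ʳ : ∀ xs → dropTrailing (xs ∷ʳ -[1+ 0 ]) ≡ dropTrailing xs
dropTrailing-∷ʳ xs = cong (reverse ∘ dropWhile (λ z → z ℤ.≟ -[1+ 0 ])) (reverse-++ xs (-[1+ 0 ] ∷ []))

𝓛-pad : ∀ t D → dropTrailing (𝓛[ -[1+ 0 ] ] (pad t D)) ≡ 𝓛 t
𝓛-pad t zero    = refl
𝓛-pad t (suc D) = trans (dropTrailing-∷ʳ (𝓛[ -[1+ 0 ] ] (pad t D))) (𝓛-pad t D)

𝓛ᵢ-graft : ∀ {k p t} (e : Graftable k p t) i → 𝓛[ i ] (graft e) ≡ (i ℤ.+ + k) ∷ 𝓛[ i ] t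
𝓛ᵢ-graft here     i = cong (_∷ []) (sym (ℤₚ.+-identityʳ i))
𝓛ᵢ-graft (left e) i = cong (_++ i ∷ []) (𝓛ᵢ-graft e i)
𝓛ᵢ-graft (right {k} {t₁ = t₁} {t₂} e) i =
  cong (_++ 𝓛[ i ] t₁ ++ i ∷ []) (trans (𝓛ᵢ-graft e (i ℤ.+ + ∣ t₁ ∣)) (cong (_∷ 𝓛[ i ℤ.+ + ∣ t₁ ∣ ] t₂) index))
  where
  index : i ℤ.+ + ∣ t₁ ∣ ℤ.+ + k ≡ i ℤ.+ + (∣ t₁ ∣ + k)
  index = trans (ℤₚ.+-assoc i (+ ∣ t₁ ∣) (+ k)) (cong (ℤ._+_ i) (sym (ℤₚ.pos-+ ∣ t₁ ∣ k)))

𝓛-graft : ∀ {n p t D} (e : Graftable (suc n) p (pad t D)) → 𝓛 (graft e) ≡ + n ∷ 𝓛 t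
𝓛-graft {n} {t = t} {D} e = begin
  dropTrailing (𝓛[ -[1+ 0 ] ] (graft e))            ≡⟨ cong dropTrailing (𝓛ᵢ-graft e -[1+ 0 ]) ⟩
  dropTrailing (+ n ∷ 𝓛[ -[1+ 0 ] ] (pad t D))       ≡⟨ dropTrailing-∷ (𝓛[ -[1+ 0 ] ] (pad t D)) (λ ()) ⟩
  + n ∷ dropTrailing (𝓛[ -[1+ 0 ] ] (pad t D))       ≡⟨ cong (+ n ∷_) (𝓛-pad t D) ⟩
  + n ∷ 𝓛 t                                         ∎
  where open ≡-Reasoning

-- Enough graftable leaves

graftable-last : ∀ {k} t → ∣ t ∣ ≡ k → Graftable k 0 ⟨ t , ⋆ ⟩
graftable-last t refl = ≡.subst (λ k → Graftable k 0 ⟨ t , ⋆ ⟩) (+-identityʳ ∣ t ∣) (right here)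

graft-graftable-self : ∀ {k p t} (e : Graftable k p t) → Graftable k (suc p) (graft e)
graft-graftable-self here      = left here
graft-graftable-self (left e)  = left (graft-graftable-self e)
graft-graftable-self (right e) = right (graft-graftable-self e)

graft-graftable-suc : ∀ {k p t} (e : Graftable k p t) → Graftable (suc k) p (graft e)
graft-graftable-suc here     = right here
graft-graftable-suc (left e) = left (graft-graftable-suc e)
graft-graftable-suc (right {k} {p} {t₁} e) =
  ≡.subst (λ j → Graftable j p ⟨ t₁ , graft e ⟩) (+-suc ∣ t₁ ∣ k) (right (graft-graftable-suc e))

graft-graftable-> : ∀ {k p j q t} (e : Graftable k p t) → Graftable j q t → k < j → Graftable (suc j) q (graft e)
graft-graftable-> (left e) (left f) k<j = left (graft-graftable-> e f k<j)
graft-graftable-> (left e) (right here) _ =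
  graftable-last (graft e) (trans (∣graft∣ e) (cong suc (sym (+-identityʳ _))))
graft-graftable-> (right {t₁ = t₁} here) (left f) k<j =
  contradiction (≤-trans (graftable-left< f) (≤-reflexive (sym (+-identityʳ ∣ t₁ ∣)))) (<⇒≯ k<j)
graft-graftable-> (right {k} {t₁ = t₁} e) (right {j} {q} f) k<j =
  ≡.subst (λ i → Graftable i q ⟨ t₁ , graft e ⟩) (+-suc ∣ t₁ ∣ j)
    (right (graft-graftable-> e f (+-cancelˡ-< ∣ t₁ ∣ k j k<j)))

GraftableAbove : ℕ → Tree → Set
GraftableAbove m t = ∀ {k} → m < k → k < ∣ t ∣ → ∃ λ p → Graftable k p t

graftableAbove-⋆ : ∀ {m} → GraftableAbove m ⋆
graftableAbove-⋆ {k = zero}  ()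
graftableAbove-⋆ {k = suc _} _ (s≤s ())

graftableAbove-mono : ∀ {m n t} → m ≤ n → GraftableAbove m t → GraftableAbove n t
graftableAbove-mono m≤n above n<k = above (≤-<-trans m≤n n<k)

graftableAbove-pad : ∀ {m t} D → GraftableAbove m t → GraftableAbove m (pad t D)
graftableAbove-pad zero    above = above
graftableAbove-pad {t = t} (suc D) above {k} m<k k<∣t∣+1 with <-≤-connex k ∣ pad t D ∣
... | inj₁ k<∣t∣ = let p , e = graftableAbove-pad D above m<k k<∣t∣ in suc p , left e
... | inj₂ ∣t∣≤k = 0 , graftable-last (pad t D) (≤-antisym ∣t∣≤k (m<n+1⇒m≤n k<∣t∣+1))
  where
  m<n+1⇒m≤n : ∀ {m n} → m < n + 1 → m ≤ n
  m<n+1⇒m≤n {m} {n} m<n+1 = m<1+n⇒m≤n (≡.subst (m <_) (+-comm n 1) m<n+1)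

graftableAbove-graft : ∀ {n p s} (e : Graftable (suc n) p s) → GraftableAbove n s → GraftableAbove n (graft e)
graftableAbove-graft {n} {p} e above {suc j} (s≤s n≤j) j<∣graft∣ with m≤n⇒m<n∨m≡n n≤j
... | inj₂ refl = suc p , graft-graftable-self e
... | inj₁ n<j with m≤n⇒m<n∨m≡n n<j
...   | inj₂ refl = p , graft-graftable-suc e
...   | inj₁ 1+n<j =
  let q , f = above (<-trans (n<1+n n) 1+n<j) (m<1+n⇒m≤n (≡.subst (suc j <_) (∣graft∣ e) j<∣graft∣))
  in q , graft-graftable-> e f 1+n<j

graftable-after-pad : ∀ {m n} t → GraftableAbove m t → m ≤ n → ∃₂ λ D p → Graftable (suc n) p (pad t D)
graftable-after-pad {n = n} t above m≤n with <-≤-connex (suc n) ∣ t ∣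
... | inj₁ 1+n<∣t∣ = 0 , above (s≤s m≤n) 1+n<∣t∣
... | inj₂ ∣t∣≤1+n = suc (suc n ∸ ∣ t ∣) , 0 , graftable-last (pad t _) (trans (∣pad∣ t _) (m∸n+n≡m ∣t∣≤1+n))

decreasing-poly-tree : ∀ n ms → Linked _≥_ (n ∷ ms) →
  ∃ λ t → 𝓛 t ≡ map +_ (n ∷ ms) × Realises (poly n ms) t × GraftableAbove n t
decreasing-poly-tree n [] _ with graftable-after-pad ⋆ graftableAbove-⋆ ≤-refl
... | D , _ , e =
  graft e , 𝓛-graft {t = ⋆} {D} e , B^nB-realises {D = D} e ,
  graftableAbove-graft e (graftableAbove-pad D graftableAbove-⋆)
decreasing-poly-tree n (m ∷ ms) (n≥m ∷ ms↓) with decreasing-poly-tree m ms ms↓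
... | t , 𝓛t , P⊨t , above with graftable-after-pad t above n≥m
...   | D , _ , e =
  graft e , trans (𝓛-graft {t = t} {D} e) (cong (+ n ∷_) 𝓛t) , ∘B-realises {D = D} P⊨t e ,
  graftableAbove-graft e (graftableAbove-pad D (graftableAbove-mono n≥m above))

lemma2p8 : (n₁ : ℕ) (ns : List ℕ) → Linked _≥_ (n₁ ∷ ns) →
    ∃ λ (t : Tree) → (𝓛 t ≡ map +_ (n₁ ∷ ns)) × (poly n₁ ns ≃βη ⟦ t ⟧)
lemma2p8 n ms ms↓ with decreasing-poly-tree n ms ms↓
... | t , 𝓛t , P⊨t , _ = t , 𝓛t , (begin
  poly n ms                         ≈⟨ lams-apps-η (poly n ms) (shift-poly 0 n ms) m ⟨
  lams m (apps (poly n ms) var m)   ≈⟨ lams-cong m (P⊨t var 0) ⟩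
  lams m (bodyWith 0 t var)         ≡⟨ cong (lams m) (body≡bodyWith-var 0 t) ⟨
  ⟦ t ⟧                             ∎)
  where
  open ≃-Reasoning
  m = ∣ t ∣
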